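{- Let $\tau$ be a functor in the sense described in the context and let $\alpha$ be a representable type. Then $\mathrm{fmap}_{\alpha,\alpha}(\mathrm{id}_\alpha) = \mathrm{id}_{\tau\cdot\alpha}$.
   Context: All types are pointed cpos (pcpos): partial orders with a least element $\bot$ in which every countable increasing chain has a least upper bound. $\alpha\to\beta$ denotes the pcpo of continuous functions from $\alpha$ to $\beta$, ordered pointwise; $\circ$ is composition and $\mathrm{id}$ the identity. Fix a pcpo $\mathcal{U}$ (the universal domain). A representable type is a pcpo $\alpha$ together with continuous maps $\mathrm{emb}_\alpha:\alpha\to\mathcal{U}$ and $\mathrm{proj}_\alpha:\mathcal{U}\to\alpha$ such that $\mathrm{proj}_\alpha\circ\mathrm{emb}_\alpha=\mathrm{id}_\alpha$ and $\mathrm{emb}_\alpha\circ\mathrm{proj}_\alpha\sqsubseteq\mathrm{id}_{\mathcal{U}}$. $\mathcal{U}$ is representable with $\mathrm{emb}_{\mathcal{U}}=\mathrm{proj}_{\mathcal{U}}=\mathrm{id}_{\mathcal{U}}$. If $\alpha,\beta$ are representable, then $\alpha\to\beta$ is representable with $\mathrm{emb}_{\alpha\to\beta}(h)=\mathrm{in}(\mathrm{emb}_\beta\circ h\circ\mathrm{proj}_\alpha)$ and $\mathrm{proj}_{\alpha\to\beta}(u)=\mathrm{proj}_\beta\circ\mathrm{out}(u)\circ\mathrm{emb}_\alpha$. Here $\mathrm{in}:(\mathcal{U}\to\mathcal{U})\to\mathcal{U}$ and $\mathrm{out}:\mathcal{U}\to(\mathcal{U}\to\mathcal{U})$ are fixed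 continuous maps with $\mathrm{out}\circ\mathrm{in}=\mathrm{id}$ and $\mathrm{in}\circ\mathrm{out}\sqsubseteq\mathrm{id}$. For representable $\alpha,\beta$, define $\mathrm{coerce}_{\alpha,\beta}=\mathrm{proj}_\beta\circ\mathrm{emb}_\alpha:\alpha\to\beta$ and $\mathrm{REP}(\alpha)=\mathrm{emb}_\alpha\circ\mathrm{proj}_\alpha$. Let $\mathcal{D}$ be the pcpo of deflations on $\mathcal{U}$, i.e. continuous $d:\mathcal{U}\to\mathcal{U}$ with $d\circ d=d\sqsubseteq\mathrm{id}_{\mathcal{U}}$, ordered pointwise; note $\mathrm{REP}(\alpha)\in\mathcal{D}$. A type constructor $\tau$ is given by a continuous map $T_\tau:\mathcal{D}\to\mathcal{D}$. For representable $\alpha$, the type $\tau\cdot\alpha$ is the sub-pcpo $\{u\in\mathcal{U}\mid T_\tau(\mathrm{REP}(\alpha))(u)=u\}$. It is represented with $\mathrm{emb}_{\tau\cdot\alpha}$ the inclusion and $\mathrm{proj}_{\tau\cdot\alpha}=T_\tau(\mathrm{REP}(\alpha))$, so $\mathrm{REP}(\tau\cdot\alpha)=T_\tau(\mathrm{REP}(\alpha))$. $\tau$ is a functor if it comes with a continuous $\underline{\mathrm{fmap}}:(\mathcal{U}\to\mathcal{U})\to(\tau\cdot\mathcal{U}\to\tau\cdot\mathcal{U})$ satisfying: (F1) for every $d\in\mathcal{D}$, $\mathrm{emb}_{\tau\cdot\mathcal{U}}\circ\underline{\mathrm{fmap}}(d)\circ\mathrm{proj}_{\tau\cdot\mathcal{U}}=T_\tau(d)$;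 (F2) $\underline{\mathrm{fmap}}(f\circ g)=\underline{\mathrm{fmap}}(f)\circ\underline{\mathrm{fmap}}(g)$ for all $f,g:\mathcal{U}\to\mathcal{U}$. For representable $\alpha,\beta$, the polymorphic map $\mathrm{fmap}_{\alpha,\beta}:(\alpha\to\beta)\to(\tau\cdot\alpha\to\tau\cdot\beta)$ is the coercion of $\underline{\mathrm{fmap}}$: $\mathrm{fmap}_{\alpha,\beta}(f)=\mathrm{coerce}_{\tau\cdot\mathcal{U},\tau\cdot\beta}\circ\underline{\mathrm{fmap}}(\mathrm{emb}_\beta\circ f\circ\mathrm{proj}_\alpha)\circ\mathrm{coerce}_{\tau\cdot\alpha,\tau\cdot\mathcal{U}}$. -}

module Defs where

open import Level using (0ℓ)
open import Data.Nat using (ℕ; suc)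
open import Function using (_∘_)
open import Relation.Binary using (Rel; IsPartialOrder; IsPreorder; IsEquivalence)

record Pcpo : Set₁ where
  infix 4 _≈_ _⊑_
  field
    Carrier        : Set
    _≈_            : Rel Carrier 0ℓ
    _⊑_            : Rel Carrier 0ℓ
    isPartialOrder : IsPartialOrder _≈_ _⊑_
    ⊥              : Carrier
    ⊥-least        : ∀ x → ⊥ ⊑ x
    ⊔              : (c : ℕ → Carrier) → (∀ n → c n ⊑ c (suc n)) → Carrier
    ⊔-ub           : ∀ c inc n → c n ⊑ ⊔ c inc
    ⊔-least        : ∀ c inc x → (∀ n → c n ⊑ x) → ⊔ c inc ⊑ x

  open IsPartialOrder isPartialOrder public
    using (antisym; reflexive; isEquivalence)
    renaming (refl to ⊑-refl; trans to ⊑-trans)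

  ≈-refl : ∀ {x} → x ≈ x
  ≈-refl = IsEquivalence.refl isEquivalence

  ≈-sym : ∀ {x y} → x ≈ y → y ≈ x
  ≈-sym = IsEquivalence.sym isEquivalence

  ≈-trans : ∀ {x y z} → x ≈ y → y ≈ z → x ≈ z
  ≈-trans = IsEquivalence.trans isEquivalence

  ⊔-cong : ∀ c d p q → (∀ n → c n ≈ d n) → ⊔ c p ≈ ⊔ d q
  ⊔-cong c d p q e =
    antisym (⊔-least c p (⊔ d q) (λ n → ⊑-trans (reflexive (e n)) (⊔-ub d q n)))
            (⊔-least d q (⊔ c p) (λ n → ⊑-trans (reflexive (≈-sym (e n))) (⊔-ub c p n)))

open Pcpo

record _⇒_ (A B : Pcpo) : Set where
  field
    fun  : Carrier A → Carrier B
    mono : ∀ {x y} → _⊑_ A x y → _⊑_ B (fun x) (fun y)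
    cont : ∀ c inc → _≈_ B (fun (⊔ A c inc)) (⊔ B (fun ∘ c) (mono ∘ inc))

  fun-cong : ∀ {x y} → _≈_ A x y → _≈_ B (fun x) (fun y)
  fun-cong e = antisym B (mono (reflexive A e)) (mono (reflexive A (≈-sym A e)))

open _⇒_

idC : (A : Pcpo) → A ⇒ A
idC A = record { fun = λ x → x ; mono = λ p → p ; cont = λ c inc → ≈-refl A }

infixr 9 _∘C_
_∘C_ : {A B C : Pcpo} → B ⇒ C → A ⇒ B → A ⇒ C
_∘C_ {A} {B} {C} g f = record
  { fun  = fun g ∘ fun f
  ; mono = mono g ∘ mono f
  ; cont = λ c inc → ≈-trans C (fun-cong g (cont f c inc)) (cont g (fun f ∘ c) (mono f ∘ inc))
  }

module _ (A B : Pcpo) where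
  private
    _≈F_ : Rel (A ⇒ B) 0ℓ
    f ≈F g = ∀ x → _≈_ B (fun f x) (fun g x)
    _⊑F_ : Rel (A ⇒ B) 0ℓ
    f ⊑F g = ∀ x → _⊑_ B (fun f x) (fun g x)

    isPO : IsPartialOrder _≈F_ _⊑F_
    isPO = record
      { isPreorder = record
        { isEquivalence = record
          { refl  = λ x → ≈-refl B
          ; sym   = λ p x → ≈-sym B (p x)
          ; trans = λ p q x → ≈-trans B (p x) (q x) }
        ; reflexive = λ p x → reflexive B (p x)
        ; trans = λ p q x → ⊑-trans B (p x) (q x) }
      ; antisym = λ p q x → antisym B (p x) (q x) }

    botF : A ⇒ B
    botF = record
      { fun  = λ _ → ⊥ B
      ; mono = λ _ → ⊑-refl B
      ; cont = λ c inc → antisym B (⊥-least B _) (⊔-least B _ _ (⊥ B) (λ n → ⊑-refl B)) }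

    lubF : (c : ℕ → A ⇒ B) → (∀ n → c n ⊑F c (suc n)) → A ⇒ B
    lubF c inc = record
      { fun  = g
      ; mono = gmono
      ; cont = λ xs xinc → antisym B
          (⊔-least B _ _ _ (λ n → ⊑-trans B (reflexive B (cont (c n) xs xinc))
             (⊔-least B _ _ _ (λ m → ⊑-trans B (⊔-ub B (λ k → fun (c k) (xs m)) (λ k → inc k (xs m)) n)
                                                (⊔-ub B (g ∘ xs) (gmono ∘ xinc) m)))))
          (⊔-least B _ _ _ (λ m → ⊔-least B _ _ _ (λ n →
             ⊑-trans B (mono (c n) (⊔-ub A xs xinc m))
                       (⊔-ub B (λ k → fun (c k) (⊔ A xs xinc)) (λ k → inc k (⊔ A xs xinc)) n)))) }
      where
        g : Carrier A → Carrier B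
        g x = ⊔ B (λ n → fun (c n) x) (λ n → inc n x)
        gmono : ∀ {x y} → _⊑_ A x y → _⊑_ B (g x) (g y)
        gmono {x} {y} p = ⊔-least B _ _ _ (λ n → ⊑-trans B (mono (c n) p) (⊔-ub B _ _ n))

  infixr 0 _⇒ₚ_
  _⇒ₚ_ : Pcpo
  _⇒ₚ_ = record
    { Carrier = A ⇒ B ; _≈_ = _≈F_ ; _⊑_ = _⊑F_ ; isPartialOrder = isPO
    ; ⊥ = botF ; ⊥-least = λ f x → ⊥-least B (fun f x)
    ; ⊔ = lubF
    ; ⊔-ub = λ c inc n x → ⊔-ub B (λ k → fun (c k) x) (λ k → inc k x) n
    ; ⊔-least = λ c inc f p x → ⊔-least B _ _ _ (λ n → p n x) }

record Deflation (U : Pcpo) : Set where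
  field
    map   : U ⇒ U
    idem  : ∀ x → _≈_ U (fun map (fun map x)) (fun map x)
    below : ∀ x → _⊑_ U (fun map x) x

open Deflation

Defl : Pcpo → Pcpo
Defl U = record
  { Carrier = Deflation U
  ; _≈_ = λ d e → _≈_ UU (map d) (map e)
  ; _⊑_ = λ d e → _⊑_ UU (map d) (map e)
  ; isPartialOrder = record
    { isPreorder = record
      { isEquivalence = record
        { refl = λ {d} → ≈-refl UU {map d}
        ; sym = λ {d} {e} → ≈-sym UU {map d} {map e}
        ; trans = λ {d} {e} {f} → ≈-trans UU {map d} {map e} {map f} }
      ; reflexive = λ {d} {e} → reflexive UU {map d} {map e}
      ; trans = λ {d} {e} {f} → ⊑-trans UU {map d} {map e} {map f} }
    ; antisym = λ {d} {e} → antisym UU {map d} {map e} }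
  ; ⊥ = record { map = ⊥ UU ; idem = λ x → ≈-refl U ; below = λ x → ⊥-least U x }
  ; ⊥-least = λ d → ⊥-least UU (map d)
  ; ⊔ = λ c inc → record
      { map = ⊔ UU (map ∘ c) inc
      ; idem = λ x → antisym U
          (below (lubD c inc) (fun (⊔ UU (map ∘ c) inc) x))
          (⊔-least U _ _ _ (λ n → ⊑-trans U (reflexive U (≈-sym U (idem (c n) x)))
             (⊑-trans U (mono (map (c n)) (⊔-ub UU (map ∘ c) inc n x))
                        (⊔-ub UU (map ∘ c) inc n _))))
      ; below = below (lubD c inc) }
  ; ⊔-ub = λ c inc → ⊔-ub UU (map ∘ c) inc
  ; ⊔-least = λ c inc d → ⊔-least UU (map ∘ c) inc (map d) }
  where
    UU = U ⇒ₚ U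
    record Below (c : ℕ → Deflation U) (inc : ∀ n → _⊑_ UU (map (c n)) (map (c (suc n)))) : Set where
      field below : ∀ x → _⊑_ U (fun (⊔ UU (map ∘ c) inc) x) x
    lubD : ∀ c inc → Below c inc
    lubD c inc = record { below = λ x → ⊔-least U _ _ x (λ n → below (c n) x) }
    open Below

record IsRep (U α : Pcpo) : Set where
  field
    emb      : α ⇒ U
    proj     : U ⇒ α
    proj-emb : ∀ x → _≈_ α (fun proj (fun emb x)) x
    emb-proj : ∀ u → _⊑_ U (fun emb (fun proj u)) u

open IsRep

idRep : (U : Pcpo) → IsRep U U
idRep U = record { emb = idC U ; proj = idC U ; proj-emb = λ x → ≈-refl U ; emb-proj = λ u → ⊑-refl U }

coerce : {U α β : Pcpo} → IsRep U α → IsRep U β → α ⇒ β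
coerce r s = proj s ∘C emb r

REP : {U α : Pcpo} → IsRep U α → Deflation U
REP {U} {α} r = record
  { map = emb r ∘C proj r
  ; idem = λ u → fun-cong (emb r) (proj-emb r (fun (proj r) u))
  ; below = emb-proj r }

record FixPt (U : Pcpo) (d : Deflation U) : Set where
  constructor _,_
  field
    elt   : Carrier U
    fixed : _≈_ U (fun (map d) elt) elt

open FixPt

Fix : (U : Pcpo) → Deflation U → Pcpo
Fix U d = record
  { Carrier = FixPt U d
  ; _≈_ = λ x y → _≈_ U (elt x) (elt y)
  ; _⊑_ = λ x y → _⊑_ U (elt x) (elt y)
  ; isPartialOrder = record
    { isPreorder = record
      { isEquivalence = record { refl = ≈-refl U ; sym = ≈-sym U ; trans = ≈-trans U }
      ; reflexive = reflexive U ; trans = ⊑-trans U }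
    ; antisym = antisym U }
  ; ⊥ = ⊥ U , antisym U (below d (⊥ U)) (⊥-least U _)
  ; ⊥-least = λ x → ⊥-least U (elt x)
  ; ⊔ = λ c inc → ⊔ U (elt ∘ c) inc ,
        ≈-trans U (cont (map d) (elt ∘ c) inc)
                  (⊔-cong U _ _ _ _ (λ n → fixed (c n)))
  ; ⊔-ub = λ c inc → ⊔-ub U (elt ∘ c) inc
  ; ⊔-least = λ c inc x → ⊔-least U (elt ∘ c) inc (elt x) }

fixRep : (U : Pcpo) (d : Deflation U) → IsRep U (Fix U d)
fixRep U d = record
  { emb = record { fun = elt ; mono = λ p → p ; cont = λ c inc → ≈-refl U }
  ; proj = record
    { fun = λ u → fun (map d) u , idem d u
    ; mono = mono (map d)
    ; cont = cont (map d) }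
  ; proj-emb = fixed
  ; emb-proj = below d }

record Universe : Set₁ where
  field
    U      : Pcpo
    inU    : (U ⇒ₚ U) ⇒ U
    outU   : U ⇒ (U ⇒ₚ U)
    out-in : ∀ f → _≈_ (U ⇒ₚ U) (fun outU (fun inU f)) f
    in-out : ∀ u → _⊑_ U (fun inU (fun outU u)) u

TypeCon : Pcpo → Set
TypeCon U = Defl U ⇒ Defl U

_·_ : {U α : Pcpo} → TypeCon U → IsRep U α → Pcpo
_·_ {U} T r = Fix U (fun T (REP r))

·Rep : {U α : Pcpo} (T : TypeCon U) (r : IsRep U α) → IsRep U (T · r)
·Rep {U} T r = fixRep U (fun T (REP r))

record IsFunctor (U : Pcpo) (T : TypeCon U) : Set where
  field
    ufmap : (U ⇒ₚ U) ⇒ ((T · idRep U) ⇒ₚ (T · idRep U))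
    F1 : ∀ (d : Deflation U) →
         _≈_ (U ⇒ₚ U)
             (emb (·Rep T (idRep U)) ∘C fun ufmap (map d) ∘C proj (·Rep T (idRep U)))
             (map (fun T d))
    F2 : ∀ (f g : U ⇒ U) →
         _≈_ ((T · idRep U) ⇒ₚ (T · idRep U))
             (fun ufmap (f ∘C g))
             (fun ufmap f ∘C fun ufmap g)

fmap : {U α β : Pcpo} {T : TypeCon U} → IsFunctor U T →
       (r : IsRep U α) (s : IsRep U β) → α ⇒ β → (T · r) ⇒ (T · s)
fmap {U} {T = T} F r s f =
  coerce (·Rep T (idRep U)) (·Rep T s)
    ∘C fun (IsFunctor.ufmap F) (emb s ∘C f ∘C proj r)
    ∘C coerce (·Rep T r) (·Rep T (idRep U))

module Submission where

-- The function emb_α ∘ id ∘ proj_α is (pointwise) the deflation REP(α), so by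
-- continuity of fmap we may replace it by REP(α); axiom (F1) at d = REP(α)
-- then identifies  emb ∘ fmap(REP α) ∘ proj  with T(REP α).  Hence
--   fmap_{α,α}(id) x = T(REP α) (T(REP α) x).
-- Finally every element of τ·α is a fixed point of the deflation T(REP α),
-- and a deflation applied twice to one of its fixed points returns it.
-- Only (F1) is needed.

open import Defs
open import Relation.Binary.Bundles using (Setoid)
import Relation.Binary.Reasoning.Setoid as SetoidReasoning
open Pcpo
open _⇒_
open IsRep
open Deflation
open FixPt

setoid : Pcpo → Setoid _ _
setoid A = record { isEquivalence = isEquivalence A }

deflation-twice-on-fixpoint : (U : Pcpo) (d : Deflation U) (x : FixPt U d) →
  _≈_ U (fun (map d) (fun (map d) (elt x))) (elt x)
deflation-twice-on-fixpoint U d x = ≈-trans U (idem d (elt x)) (fixed x)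

module _ (V : Universe) (T : TypeCon (Universe.U V)) (F : IsFunctor (Universe.U V) T) where
  open Universe V using (U)
  open IsFunctor F
  open SetoidReasoning (setoid U)

  τU : IsRep U (T · idRep U)
  τU = ·Rep T (idRep U)

  fmap-deflation : (d : Deflation U) (u : Carrier U) →
    _≈_ U (elt (fun (fun ufmap (map d)) (fun (proj τU) u))) (fun (map (fun T d)) u)
  fmap-deflation = F1

  fmap-id-elt : {α : Pcpo} (r : IsRep U α) (x : FixPt U (fun T (REP r))) →
    _≈_ U (elt (fun (fmap F r r (idC α)) x))
          (fun (map (fun T (REP r))) (fun (map (fun T (REP r))) (elt x)))
  fmap-id-elt {α} r x = fun-cong TR (begin
      elt (fun (fun ufmap (emb r ∘C idC α ∘C proj r)) y)
        ≈⟨ fun-cong ufmap emb-id-proj≈REP y ⟩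
      elt (fun (fun ufmap (map (REP r))) y)
        ≈⟨ fmap-deflation (REP r) (elt x) ⟩
      fun TR (elt x)
    ∎)
    where
      TR : U ⇒ U
      TR = map (fun T (REP r))
      y : FixPt U (fun T (REP (idRep U)))
      y = fun (proj τU) (elt x)
      emb-id-proj≈REP : _≈_ (U ⇒ₚ U) (emb r ∘C idC α ∘C proj r) (map (REP r))
      emb-id-proj≈REP u = ≈-refl U

theorem1 : (V : Universe) (T : TypeCon (Universe.U V)) (F : IsFunctor (Universe.U V) T)
    (α : Pcpo) (r : IsRep (Universe.U V) α) →
    Pcpo._≈_ ((T · r) ⇒ₚ (T · r)) (fmap F r r (idC α)) (idC (T · r))
theorem1 V T F α r x =
  ≈-trans U (fmap-id-elt V T F r x)
            (deflation-twice-on-fixpoint U (fun T (REP r)) x)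
  where
    U : Pcpo
    U = Universe.U V
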